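{- Let $\mathcal{O}$ be an indecomposable poset with at least 5 vertices and let $x$ be a vertex of $\mathcal{O}$. Then $\mathcal{O}$ is (-1)-critical at $x$ (i.e. $x$ is the unique non-critical vertex of $\mathcal{O}$) if and only if its comparability graph $\overleftrightarrow{\mathcal{O}}$ is (-1)-critical at $x$ (i.e. $\overleftrightarrow{\mathcal{O}}$ is indecomposable and $x$ is its unique non-critical vertex).
   Context: A digraph has a finite vertex set and arcs which are ordered pairs of distinct vertices; a graph has edges which are 2-subsets of vertices. For a (di)graph $D$ and $X\subseteq V(D)$, $D[X]$ is the induced sub(di)graph and $D-x=D[V(D)\setminus\{x\}]$. A subset $I\subseteq V(D)$ is an interval of a digraph $D$ if for all $a,b\in I$ and $x\notin I$: $(a,x)\in A(D)\Leftrightarrow(b,x)\in A(D)$ and $(x,a)\in A(D)\Leftrightarrow(x,b)\in A(D)$; for a graph, $\{a,x\}$ is an edge iff $\{b,x\}$ is an edge. Trivial intervals: $\varnothing$, $V(D)$, singletons. $D$ is indecomposable if $|V(D)|\ge3$ and all its intervals are trivial. In an indecomposable $D$, a vertex $x$ is critical if $D-x$ is decomposable. A poset is a transitive digraph. Its comparability graph $\overleftrightarrow{\mathcal{O}}$ has the same vertex set and $\{x,y\}$ is an edge iff $(x,y)$ or $(y,x)$ is an arc of $\mathcal{O}$. -}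

module Defs where

open import Data.Nat using (ℕ; _≤_)
open import Data.Fin using (Fin)
open import Data.Bool using (Bool; true; false; T; not; _∧_)
open import Data.Product using (_×_; ∃; ∃-syntax)
open import Data.Sum using (_⊎_)
open import Relation.Nullary using (¬_)
open import Relation.Binary.PropositionalEquality using (_≡_; _≢_)
open import Function.Bundles using (_⇔_)
open import Data.Fin.Subset using (Subset; ∣_∣)
import Data.Vec as Vec
open import Data.Fin.Properties using (_≟_)
open import Relation.Nullary.Decidable using (⌊_⌋)

Rel : ℕ → Set
Rel n = Fin n → Fin n → Bool

IsDigraph : ∀ {n} → Rel n → Set
IsDigraph D = ∀ a → D a a ≡ false

IsGraph : ∀ {n} → Rel n → Set
IsGraph G = IsDigraph G × (∀ a b → G a b ≡ G b a)

-- A poset (strict form, as a transitive digraph).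
IsPoset : ∀ {n} → Rel n → Set
IsPoset O = IsDigraph O × (∀ a b c → T (O a b) → T (O b c) → T (O a c))

comparability : ∀ {n} → Rel n → Rel n
comparability O a b = O a b Data.Bool.∨ O b a

_∈ₛ_ : ∀ {n} → Fin n → Subset n → Set
a ∈ₛ V = T (Vec.lookup V a)

_⊆ₛ_ : ∀ {n} → Subset n → Subset n → Set
I ⊆ₛ V = ∀ a → a ∈ₛ I → a ∈ₛ V

-- I is an interval of the induced sub(di)graph D[V] (requires I ⊆ V).
-- For a graph (symmetric D) the two conditions coincide with the graph definition.
IsInterval : ∀ {n} → Rel n → Subset n → Subset n → Set
IsInterval D V I =
  I ⊆ₛ V ×
  (∀ a b x → a ∈ₛ I → b ∈ₛ I → x ∈ₛ V → ¬ (x ∈ₛ I) →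
     (T (D a x) ⇔ T (D b x)) × (T (D x a) ⇔ T (D x b)))

IsTrivial : ∀ {n} → Subset n → Subset n → Set
IsTrivial V I =
  (∀ a → ¬ (a ∈ₛ I)) ⊎
  (∀ a → a ∈ₛ V → a ∈ₛ I) ⊎
  (∃[ c ] (∀ a → a ∈ₛ I ⇔ a ≡ c))

IndecomposableOn : ∀ {n} → Rel n → Subset n → Set
IndecomposableOn D V = 3 ≤ ∣ V ∣ × (∀ I → IsInterval D V I → IsTrivial V I)

full : ∀ {n} → Subset n
full = Vec.replicate _ true

remove : ∀ {n} → Fin n → Subset n
remove x = Vec.tabulate (λ a → not ⌊ a ≟ x ⌋)

Indecomposable : ∀ {n} → Rel n → Set
Indecomposable D = IndecomposableOn D full

Critical : ∀ {n} → Rel n → Fin n → Set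
Critical D x = Indecomposable D × ¬ IndecomposableOn D (remove x)

MinusOneCriticalAt : ∀ {n} → Rel n → Fin n → Set
MinusOneCriticalAt D x =
  Indecomposable D × ¬ Critical D x × (∀ y → y ≢ x → Critical D y)

{-# OPTIONS --safe #-}
module Submission where

-- For a poset O, an induced subposet O[W] is indecomposable exactly when its
-- comparability graph is; since (-1)-criticality only speaks about the
-- indecomposability of O and of the O - y, it transfers between O and its
-- comparability graph.
--
-- Intervals of O[W] are intervals of the comparability graph. Conversely let I
-- be an interval of the comparability graph of an indecomposable O[W]. A vertex
-- w ∉ I that distinguishes a, b ∈ I in O is comparable to both, hence lies
-- strictly between them. If I ≠ W, the class of c ∈ I under "no outside vertex
-- distinguishes" is an O-interval, hence {c}, so I is a chain. A vertex w ∉ I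
-- with a < w < b (a, b ∈ I) is then impossible: the segment [a, b] ∩ W would be
-- an O-interval, hence all of W, making a the minimum of W, and then W - a is a
-- nontrivial O-interval. So no outside vertex distinguishes two points of I,
-- i.e. I is an O-interval.

open import Data.Nat using (ℕ; _≤_)
open import Data.Fin using (Fin)
open import Data.Fin.Properties using (_≟_; any?)
open import Data.Fin.Subset using (Subset)
open import Data.Bool using (true; false; T; _∨_)
open import Data.Bool.Properties using (T?; T-≡) renaming (_≟_ to _≟ᵇ_)
open import Data.Product using (_×_; _,_; proj₁; proj₂; ∃; ∃₂; uncurry)
open import Data.Sum using (_⊎_; inj₁; inj₂; [_,_])
open import Data.Empty using (⊥; ⊥-elim)
open import Data.Unit using (tt)
open import Data.Vec using (lookup; tabulate)
open import Data.Vec.Properties using (lookup∘tabulate)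
open import Function.Base using (id; _∘_)
open import Function.Bundles using (_⇔_; mk⇔; Equivalence)
open import Function.Construct.Symmetry using (⇔-sym)
open import Relation.Nullary using (¬_; Dec; yes; no; contradiction)
open import Relation.Nullary.Decidable
  using (⌊_⌋; toWitness; fromWitness; does-⇔; decidable-stable; _×-dec_; _⊎-dec_; ¬?)
open import Relation.Unary using (Decidable)
open import Relation.Binary.PropositionalEquality using (_≡_; _≢_; refl; sym; trans; subst; cong₂; ≢-sym)

open import Defs

open Equivalence using (to; from)

private
  variable
    n : ℕ

T-cong : ∀ {p q} → p ≡ q → T p ⇔ T q
T-cong refl = mk⇔ id id

T-injective : ∀ {p q} → T p ⇔ T q → p ≡ q
T-injective {p} {q} h = does-⇔ h (T? p) (T? q)

¬T⇒≡false : ∀ {p} → ¬ T p → p ≡ false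
¬T⇒≡false {p} ¬p = does-⇔ (mk⇔ ¬p ⊥-elim) (T? p) (T? false)

_∈?_ : (a : Fin n) (V : Subset n) → Dec (a ∈ₛ V)
a ∈? V = T? (lookup V a)

subsetOf : {P : Fin n → Set} → Decidable P → Subset n
subsetOf P? = tabulate (λ a → ⌊ P? a ⌋)

∈-subsetOf : {P : Fin n → Set} (P? : Decidable P) {a : Fin n} → a ∈ₛ subsetOf P? ⇔ P a
∈-subsetOf P? {a} = mk⇔
  (λ m → toWitness (subst T (lookup∘tabulate (λ b → ⌊ P? b ⌋) a) m))
  (λ p → subst T (sym (lookup∘tabulate (λ b → ⌊ P? b ⌋) a)) (fromWitness p))

trivial-∋-distinct⇒⊇ : {V J : Subset n} {a b : Fin n} →
  IsTrivial V J → a ∈ₛ J → b ∈ₛ J → a ≢ b → V ⊆ₛ J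
trivial-∋-distinct⇒⊇ (inj₁ empty) a∈J _ _ = ⊥-elim (empty _ a∈J)
trivial-∋-distinct⇒⊇ (inj₂ (inj₁ V⊆J)) _ _ _ = V⊆J
trivial-∋-distinct⇒⊇ (inj₂ (inj₂ (c , J≡c))) a∈J b∈J a≢b =
  ⊥-elim (a≢b (trans (to (J≡c _) a∈J) (sym (to (J≡c _) b∈J))))

Uniform : Rel n → Subset n → Fin n → Set
Uniform D J z = ∃₂ λ p q → ∀ v → v ∈ₛ J → D v z ≡ p × D z v ≡ q

uniform⇒interval : {D : Rel n} {V J : Subset n} → J ⊆ₛ V →
  (∀ z → z ∈ₛ V → ¬ z ∈ₛ J → Uniform D J z) → IsInterval D V J
uniform⇒interval J⊆V uniform = J⊆V , λ a b z a∈J b∈J z∈V z∉J →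
  let (_ , _ , same) = uniform z z∈V z∉J in
  T-cong (trans (proj₁ (same a a∈J)) (sym (proj₁ (same b b∈J)))) ,
  T-cong (trans (proj₂ (same a a∈J)) (sym (proj₂ (same b b∈J))))

interval⇒comparability-interval : {D : Rel n} {V I : Subset n} →
  IsInterval D V I → IsInterval (comparability D) V I
interval⇒comparability-interval (I⊆V , agree) = I⊆V , λ a b z a∈I b∈I z∈V z∉I →
  let (out , into) = agree a b z a∈I b∈I z∈V z∉I in
  T-cong (cong₂ _∨_ (T-injective out) (T-injective into)) ,
  T-cong (cong₂ _∨_ (T-injective into) (T-injective out))

disagreement⇒between : ∀ az za bz zb → az ∨ za ≡ bz ∨ zb →
  ¬ (T az × T za) → ¬ (T bz × T zb) → ¬ (az ≡ bz × za ≡ zb) →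
  (T az × T zb) ⊎ (T bz × T za)
disagreement⇒between true  true  _     _     _  asym _    _     = ⊥-elim (asym (tt , tt))
disagreement⇒between _     _     true  true  _  _    asym _     = ⊥-elim (asym (tt , tt))
disagreement⇒between true  false false true  _  _    _    _     = inj₁ (tt , tt)
disagreement⇒between false true  true  false _  _    _    _     = inj₂ (tt , tt)
disagreement⇒between true  false true  false _  _    _    ¬same = ⊥-elim (¬same (refl , refl))
disagreement⇒between false true  false true  _  _    _    ¬same = ⊥-elim (¬same (refl , refl))
disagreement⇒between false false false false _  _    _    ¬same = ⊥-elim (¬same (refl , refl))
disagreement⇒between true  false false false () _    _    _
disagreement⇒between false true  false false () _    _    _
disagreement⇒between false false true  false () _    _    _
disagreement⇒between false false false true  () _    _    _

module _ {O : Rel n} (poset : IsPoset O) where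

  _≺_ : Fin n → Fin n → Set
  a ≺ b = T (O a b)

  _≼_ : Fin n → Fin n → Set
  a ≼ b = a ≡ b ⊎ a ≺ b

  _≼?_ : ∀ a b → Dec (a ≼ b)
  a ≼? b = (a ≟ b) ⊎-dec T? (O a b)

  ≺-irrefl : ∀ {a b} → a ≡ b → ¬ a ≺ b
  ≺-irrefl {a} refl = subst T (proj₁ poset a)

  ≺⇒≢ : ∀ {a b} → a ≺ b → a ≢ b
  ≺⇒≢ a≺b a≡b = ≺-irrefl a≡b a≺b

  ≺-trans : ∀ {a b c} → a ≺ b → b ≺ c → a ≺ c
  ≺-trans = proj₂ poset _ _ _

  ≺-asym : ∀ {a b} → a ≺ b → ¬ b ≺ a
  ≺-asym a≺b b≺a = ≺-irrefl refl (≺-trans a≺b b≺a)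

  ≼-≺-trans : ∀ {a b c} → a ≼ b → b ≺ c → a ≺ c
  ≼-≺-trans (inj₁ refl) b≺c = b≺c
  ≼-≺-trans (inj₂ a≺b)  b≺c = ≺-trans a≺b b≺c

  ≺-≼-trans : ∀ {a b c} → a ≺ b → b ≼ c → a ≺ c
  ≺-≼-trans a≺b (inj₁ refl) = a≺b
  ≺-≼-trans a≺b (inj₂ b≺c)  = ≺-trans a≺b b≺c

  uniform-below : ∀ {J z} → (∀ v → v ∈ₛ J → z ≺ v) → Uniform O J z
  uniform-below z≺ = false , true , λ v v∈J →
    ¬T⇒≡false (≺-asym (z≺ v v∈J)) , to T-≡ (z≺ v v∈J)

  uniform-above : ∀ {J z} → (∀ v → v ∈ₛ J → v ≺ z) → Uniform O J z
  uniform-above ≺z = true , false , λ v v∈J →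
    to T-≡ (≺z v v∈J) , ¬T⇒≡false (≺-asym (≺z v v∈J))

  Agree : Fin n → Fin n → Fin n → Set
  Agree a b z = O a z ≡ O b z × O z a ≡ O z b

  agree? : ∀ a b z → Dec (Agree a b z)
  agree? a b z = (O a z ≟ᵇ O b z) ×-dec (O z a ≟ᵇ O z b)

  _-_ : Subset n → Fin n → Subset n
  W - a = subsetOf (λ v → (v ∈? W) ×-dec ¬? (v ≟ a))

  ∈-minus : ∀ {W a v} → v ∈ₛ (W - a) ⇔ (v ∈ₛ W × v ≢ a)
  ∈-minus {W} {a} = ∈-subsetOf (λ v → (v ∈? W) ×-dec ¬? (v ≟ a))

  minimum-deleted-interval : ∀ {W a} → (∀ v → v ∈ₛ W → a ≼ v) → IsInterval O W (W - a)
  minimum-deleted-interval {W} {a} minimum =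
    uniform⇒interval {V = W} {J = W - a} (λ v → proj₁ ∘ to (∈-minus {W} {a})) uniform
    where
    uniform : ∀ z → z ∈ₛ W → ¬ z ∈ₛ (W - a) → Uniform O (W - a) z
    uniform z z∈W z∉W-a with z ≟ a
    ... | no z≢a = contradiction (from (∈-minus {W} {a}) (z∈W , z≢a)) z∉W-a
    ... | yes refl = uniform-below {J = W - z} λ v v∈W-a →
      let (v∈W , v≢z) = to (∈-minus {W} {z}) v∈W-a in
      [ (λ z≡v → ⊥-elim (v≢z (sym z≡v))) , id ] (minimum v v∈W)

  segment : Subset n → Fin n → Fin n → Subset n
  segment W a b = subsetOf (λ v → (v ∈? W) ×-dec (a ≼? v) ×-dec (v ≼? b))

  ∈-segment : ∀ {W a b v} → v ∈ₛ segment W a b ⇔ (v ∈ₛ W × a ≼ v × v ≼ b)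
  ∈-segment {W} {a} {b} = ∈-subsetOf (λ v → (v ∈? W) ×-dec (a ≼? v) ×-dec (v ≼? b))

  segment-uniform : ∀ {W a b z} → z ≺ a ⊎ b ≺ z ⊎ (¬ a ≺ z × ¬ z ≺ b) →
                    Uniform O (segment W a b) z
  segment-uniform {W} {a} {b} (inj₁ z≺a) = uniform-below {J = segment W a b} λ v v∈segment →
    ≺-≼-trans z≺a (proj₁ (proj₂ (to (∈-segment {W}) v∈segment)))
  segment-uniform {W} {a} {b} (inj₂ (inj₁ b≺z)) = uniform-above {J = segment W a b} λ v v∈segment →
    ≼-≺-trans (proj₂ (proj₂ (to (∈-segment {W}) v∈segment))) b≺z
  segment-uniform {W} (inj₂ (inj₂ (a⊀z , z⊀b))) = false , false , λ v v∈segment →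
    let (_ , a≼v , v≼b) = to (∈-segment {W}) v∈segment in
    ¬T⇒≡false (a⊀z ∘ ≼-≺-trans a≼v) , ¬T⇒≡false (λ z≺v → z⊀b (≺-≼-trans z≺v v≼b))

  module _ {W I : Subset n} (I-interval : IsInterval (comparability O) W I) where

    Separates : Fin n → Fin n → Fin n → Set
    Separates a b w = w ∈ₛ W × ¬ w ∈ₛ I × ¬ Agree a b w

    separates? : ∀ a b w → Dec (Separates a b w)
    separates? a b w = (w ∈? W) ×-dec ¬? (w ∈? I) ×-dec ¬? (agree? a b w)

    agree-outside : ∀ {a b w} → ¬ ∃ (Separates a b) → w ∈ₛ W → ¬ w ∈ₛ I → Agree a b w
    agree-outside {a} {b} {w} unseparated w∈W w∉I =
      decidable-stable (agree? a b w) λ ¬agree → unseparated (w , w∈W , w∉I , ¬agree)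

    separator-between : ∀ {a b w} → a ∈ₛ I → b ∈ₛ I → Separates a b w →
                        (a ≺ w × w ≺ b) ⊎ (b ≺ w × w ≺ a)
    separator-between {a} {b} {w} a∈I b∈I (w∈W , w∉I , ¬agree) =
      disagreement⇒between (O a w) (O w a) (O b w) (O w b)
        (T-injective (proj₁ (proj₂ I-interval a b w a∈I b∈I w∈W w∉I)))
        (uncurry ≺-asym) (uncurry ≺-asym) ¬agree

    agree-off-segment : ∀ {a b z} → a ∈ₛ I → b ∈ₛ I → z ∈ₛ W → ¬ z ∈ₛ I → a ≺ b →
                        ¬ z ∈ₛ segment W a b → Agree a b z
    agree-off-segment {a} {b} {z} a∈I b∈I z∈W z∉I a≺b z∉segment =
      decidable-stable (agree? a b z) λ ¬agree →
        [ (λ (a≺z , z≺b) → z∉segment (from (∈-segment {W}) (z∈W , inj₂ a≺z , inj₂ z≺b))) ,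
          (λ (b≺z , z≺a) → ≺-asym a≺b (≺-trans b≺z z≺a)) ]
        (separator-between a∈I b∈I (z∈W , z∉I , ¬agree))

    position-outside : ∀ {a b z} → a ∈ₛ I → b ∈ₛ I → z ∈ₛ W → ¬ z ∈ₛ I → a ≺ b →
                       ¬ z ∈ₛ segment W a b → z ≺ a ⊎ b ≺ z ⊎ (¬ a ≺ z × ¬ z ≺ b)
    position-outside {a} {b} {z} a∈I b∈I z∈W z∉I a≺b z∉segment
      with agree-off-segment a∈I b∈I z∈W z∉I a≺b z∉segment | T? (O z a) | T? (O a z)
    ... | _             | yes z≺a | _       = inj₁ z≺a
    ... | (out , _)     | no _    | yes a≺z = inj₂ (inj₁ (subst T out a≺z))
    ... | (_ , into)    | no z⊀a  | no a⊀z  = inj₂ (inj₂ (a⊀z , z⊀a ∘ subst T (sym into)))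

    module _ (trivial : ∀ J → IsInterval O W J → IsTrivial W J) where

      twins : Fin n → Subset n
      twins c = subsetOf (λ v → (v ∈? I) ×-dec ¬? (any? (separates? c v)))

      ∈-twins : ∀ {c v} → v ∈ₛ twins c ⇔ (v ∈ₛ I × ¬ ∃ (Separates c v))
      ∈-twins {c} = ∈-subsetOf (λ v → (v ∈? I) ×-dec ¬? (any? (separates? c v)))

      ∉-twins⇒separated : ∀ {c v} → v ∈ₛ I → ¬ v ∈ₛ twins c → ∃ (Separates c v)
      ∉-twins⇒separated {c} {v} v∈I v∉twins =
        decidable-stable (any? (separates? c v)) λ unseparated →
          v∉twins (from (∈-twins {c}) (v∈I , unseparated))

      ∈-twins-self : ∀ {c} → c ∈ₛ I → c ∈ₛ twins c
      ∈-twins-self {c} c∈I =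
        from (∈-twins {c}) (c∈I , λ (_ , _ , _ , ¬agree) → ¬agree (refl , refl))

      twins-interval : ∀ {c} → c ∈ₛ I → IsInterval O W (twins c)
      twins-interval {c} c∈I =
        uniform⇒interval {V = W} {J = twins c}
          (λ v → proj₁ I-interval v ∘ proj₁ ∘ to (∈-twins {c})) uniform
        where
        agree-with-twin : ∀ {v w} → v ∈ₛ twins c → w ∈ₛ W → ¬ w ∈ₛ I → Agree c v w
        agree-with-twin v∈twins = agree-outside (proj₂ (to (∈-twins {c}) v∈twins))

        uniform : ∀ z → z ∈ₛ W → ¬ z ∈ₛ twins c → Uniform O (twins c) z
        uniform z z∈W z∉twins with z ∈? I
        ... | no z∉I = O c z , O z c , λ v v∈twins →
          let (out , into) = agree-with-twin v∈twins z∈W z∉I in sym out , sym into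
        ... | yes z∈I with ∉-twins⇒separated z∈I z∉twins
        ... | w , separation@(w∈W , w∉I , _) with separator-between c∈I z∈I separation
        ... | inj₁ (c≺w , w≺z) = uniform-above {J = twins c} λ v v∈twins →
          ≺-trans (subst T (proj₁ (agree-with-twin v∈twins w∈W w∉I)) c≺w) w≺z
        ... | inj₂ (z≺w , w≺c) = uniform-below {J = twins c} λ v v∈twins →
          ≺-trans z≺w (subst T (proj₂ (agree-with-twin v∈twins w∈W w∉I)) w≺c)

      module _ {x} (x∈W : x ∈ₛ W) (x∉I : ¬ x ∈ₛ I) where

        twin⇒≡ : ∀ {c t} → c ∈ₛ I → t ∈ₛ twins c → c ≡ t
        twin⇒≡ {c} {t} c∈I t∈twins = decidable-stable (c ≟ t) λ c≢t →
          let W⊆twins = trivial-∋-distinct⇒⊇ {V = W} {J = twins c}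
                          (trivial (twins c) (twins-interval c∈I))
                          (∈-twins-self c∈I) t∈twins c≢t
          in x∉I (proj₁ (to (∈-twins {c}) (W⊆twins x x∈W)))

        comparable : ∀ {c t} → c ∈ₛ I → t ∈ₛ I → c ≢ t → c ≺ t ⊎ t ≺ c
        comparable c∈I t∈I c≢t
          with ∉-twins⇒separated t∈I (c≢t ∘ twin⇒≡ c∈I)
        ... | w , separation with separator-between c∈I t∈I separation
        ... | inj₁ (c≺w , w≺t) = inj₁ (≺-trans c≺w w≺t)
        ... | inj₂ (t≺w , w≺c) = inj₂ (≺-trans t≺w w≺c)

        position-inside : ∀ {a b z} → a ∈ₛ I → b ∈ₛ I → z ∈ₛ I → z ∈ₛ W → a ≺ b →
                          ¬ z ∈ₛ segment W a b → z ≺ a ⊎ b ≺ z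
        position-inside a∈I b∈I z∈I z∈W a≺b z∉segment
          with comparable a∈I z∈I (λ { refl → z∉segment (from (∈-segment {W}) (z∈W , inj₁ refl , inj₂ a≺b)) })
        ... | inj₂ z≺a = inj₁ z≺a
        ... | inj₁ a≺z
          with comparable b∈I z∈I (λ { refl → z∉segment (from (∈-segment {W}) (z∈W , inj₂ a≺b , inj₁ refl)) })
        ... | inj₁ b≺z = inj₂ b≺z
        ... | inj₂ z≺b = ⊥-elim (z∉segment (from (∈-segment {W}) (z∈W , inj₂ a≺z , inj₂ z≺b)))

        segment-interval : ∀ {a b} → a ∈ₛ I → b ∈ₛ I → a ≺ b → IsInterval O W (segment W a b)
        segment-interval {a} {b} a∈I b∈I a≺b =
          uniform⇒interval {V = W} {J = segment W a b} (λ v → proj₁ ∘ to (∈-segment {W}))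
            λ z z∈W z∉segment → segment-uniform {W} (position z z∈W z∉segment)
          where
          position : ∀ z → z ∈ₛ W → ¬ z ∈ₛ segment W a b → z ≺ a ⊎ b ≺ z ⊎ (¬ a ≺ z × ¬ z ≺ b)
          position z z∈W z∉segment with z ∈? I
          ... | yes z∈I = [ inj₁ , inj₂ ∘ inj₁ ] (position-inside a∈I b∈I z∈I z∈W a≺b z∉segment)
          ... | no z∉I  = position-outside a∈I b∈I z∈W z∉I a≺b z∉segment

        no-sandwich : ∀ {a b} → a ∈ₛ I → b ∈ₛ I → a ≺ x → x ≺ b → ⊥
        no-sandwich {a} {b} a∈I b∈I a≺x x≺b = proj₂ (to (∈-minus {W} {a}) (W⊆W-a a a∈W)) refl
          where
          a≺b : a ≺ b
          a≺b = ≺-trans a≺x x≺b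

          a∈W : a ∈ₛ W
          a∈W = proj₁ I-interval a a∈I

          b∈W : b ∈ₛ W
          b∈W = proj₁ I-interval b b∈I

          W⊆segment : W ⊆ₛ segment W a b
          W⊆segment = trivial-∋-distinct⇒⊇ {V = W} {J = segment W a b}
            (trivial (segment W a b) (segment-interval a∈I b∈I a≺b))
            (from (∈-segment {W}) (a∈W , inj₁ refl , inj₂ a≺b))
            (from (∈-segment {W}) (b∈W , inj₂ a≺b , inj₁ refl))
            (≺⇒≢ a≺b)

          a-minimum : ∀ v → v ∈ₛ W → a ≼ v
          a-minimum v v∈W = proj₁ (proj₂ (to (∈-segment {W}) (W⊆segment v v∈W)))

          W⊆W-a : W ⊆ₛ (W - a)
          W⊆W-a = trivial-∋-distinct⇒⊇ {V = W} {J = W - a}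
            (trivial (W - a) (minimum-deleted-interval {W} a-minimum))
            (from (∈-minus {W} {a}) (x∈W , ≢-sym (≺⇒≢ a≺x)))
            (from (∈-minus {W} {a}) (b∈W , ≢-sym (≺⇒≢ a≺b)))
            (≺⇒≢ x≺b)

      comparability-interval⇒interval : IsInterval O W I
      comparability-interval⇒interval = proj₁ I-interval , λ a b z a∈I b∈I z∈W z∉I →
        let (out , into) = decidable-stable (agree? a b z) λ ¬agree →
              [ uncurry (no-sandwich z∈W z∉I a∈I b∈I) , uncurry (no-sandwich z∈W z∉I b∈I a∈I) ]
                (separator-between a∈I b∈I (z∈W , z∉I , ¬agree))
        in T-cong out , T-cong into

indecomposableOn-comparability : {O : Rel n} → IsPoset O → (W : Subset n) →
  IndecomposableOn O W ⇔ IndecomposableOn (comparability O) W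
indecomposableOn-comparability poset W = mk⇔
  (λ (size , trivial) → size , λ I I-interval →
     trivial I (comparability-interval⇒interval poset {W} {I} I-interval trivial))
  (λ (size , trivial) → size , λ I I-interval →
     trivial I (interval⇒comparability-interval {V = W} {I = I} I-interval))

critical-transfer : {D D′ : Rel n} → (∀ W → IndecomposableOn D W ⇔ IndecomposableOn D′ W) →
                    ∀ {y} → Critical D y → Critical D′ y
critical-transfer same {y} (indecomposable , decomposable) =
  to (same full) indecomposable , decomposable ∘ from (same (remove y))

minusOneCriticalAt-transfer : {D D′ : Rel n} →
  (∀ W → IndecomposableOn D W ⇔ IndecomposableOn D′ W) →
  ∀ {x} → MinusOneCriticalAt D x → MinusOneCriticalAt D′ x
minusOneCriticalAt-transfer same (indecomposable , x-noncritical , others-critical) =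
  to (same full) indecomposable ,
  x-noncritical ∘ critical-transfer (⇔-sym ∘ same) ,
  λ y y≢x → critical-transfer same (others-critical y y≢x)

minusOneCriticalAt-cong : {D D′ : Rel n} → (∀ W → IndecomposableOn D W ⇔ IndecomposableOn D′ W) →
                          ∀ {x} → MinusOneCriticalAt D x ⇔ MinusOneCriticalAt D′ x
minusOneCriticalAt-cong same =
  mk⇔ (minusOneCriticalAt-transfer same) (minusOneCriticalAt-transfer (⇔-sym ∘ same))

mainTheorem2 : (n : ℕ) → (O : Rel n) → IsPoset O → Indecomposable O → 5 ≤ n →
               (x : Fin n) →
               MinusOneCriticalAt O x ⇔ MinusOneCriticalAt (comparability O) x
mainTheorem2 _ _ poset _ _ _ = minusOneCriticalAt-cong (indecomposableOn-comparability poset)
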